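{- Every outerplanar graph $G$ has an equitable $t$-tree-coloring for every integer $t\ge 2$; that is, $va^{\equiv}_{\infty,\infty}(G)=2$ if $G$ is not a forest and $va^{\equiv}_{\infty,\infty}(G)=1$ otherwise.
   Context: A graph is outerplanar if it can be drawn in the plane without crossings so that all vertices lie on the outer face. A $t$-coloring of $G$ is a map $f:V(G)\to\{1,\dots,t\}$ (not necessarily surjective) with color classes $V_i=f^{ -1}(i)$; it is equitable if $||V_i|-|V_j||\le 1$ for all $i,j$. An equitable $t$-tree-coloring is an equitable $t$-coloring in which every color class induces a forest. $va^{\equiv}_{\infty,\infty}(G)$ is the smallest positive integer $t$ such that $G$ has an equitable $t'$-tree-coloring for every integer $t'\ge t$. -}

module Defs where

open import Data.Nat using (ℕ; zero; suc; _+_; _≤_; _<_)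
open import Data.Fin using (Fin; toℕ; _≟_)
open import Data.Bool using (Bool; true; false)
open import Data.List using (List; []; _∷_; length; filter; allFin)
open import Data.List.Relation.Unary.All using (All)
open import Data.List.Relation.Unary.Unique.Propositional using (Unique)
open import Data.Product using (Σ; _×_; ∃)
open import Data.Empty using (⊥)
open import Relation.Nullary using (¬_)
open import Relation.Binary.PropositionalEquality using (_≡_)
open import Function.Bundles using (_↔_)

record Graph (n : ℕ) : Set where
  field
    adj     : Fin n → Fin n → Bool
    adj-sym : ∀ u v → adj u v ≡ adj v u
    irrefl  : ∀ v → adj v v ≡ false
open Graph public

Adj : ∀ {n} → Graph n → Fin n → Fin n → Set
Adj G u v = adj G u v ≡ true

-- Outerplanar: a drawing with all vertices on the outer face is (up to
-- homeomorphism) a placement of the vertices in convex position on a circle,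
-- in some cyclic order, with edges as chords, no two of which cross.
-- pos v is the position of v along the circle.
Outerplanar : ∀ {n} → Graph n → Set
Outerplanar {n} G =
  Σ (Fin n ↔ Fin n) λ pos →
    let p = λ v → toℕ (Function.Bundles.Inverse.to pos v) in
    ∀ a b c d → Adj G a b → Adj G c d →
      ¬ (p a < p c × p c < p b × p b < p d)

data Path {n} (G : Graph n) : List (Fin n) → Set where
  single : ∀ v → Path G (v ∷ [])
  cons   : ∀ u v vs → Adj G u v → Path G (v ∷ vs) → Path G (u ∷ v ∷ vs)

last : ∀ {n} → Fin n → List (Fin n) → Fin n
last v []       = v
last v (w ∷ ws) = last w ws

record CycleIn {n} (G : Graph n) (S : Fin n → Set) : Set where
  field
    v₀      : Fin n
    rest    : List (Fin n)
    long    : 2 ≤ length rest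
    path    : Path G (v₀ ∷ rest)
    closing : Adj G (last v₀ rest) v₀
    distinct : Unique (v₀ ∷ rest)
    inS     : All S (v₀ ∷ rest)

InducesForest : ∀ {n} → Graph n → (Fin n → Set) → Set
InducesForest G S = ¬ CycleIn G S

IsForest : ∀ {n} → Graph n → Set
IsForest G = InducesForest G (λ _ → Data.Unit.⊤)
  where import Data.Unit

classSize : ∀ {n t} → (Fin n → Fin t) → Fin t → ℕ
classSize {n} f i = length (filter (λ v → f v ≟ i) (allFin n))

Equitable : ∀ {n t} → (Fin n → Fin t) → Set
Equitable {t = t} f = ∀ (i j : Fin t) → classSize f i ≤ classSize f j + 1

IsEquitableTreeColoring : ∀ {n t} → Graph n → (Fin n → Fin t) → Set
IsEquitableTreeColoring {t = t} G f =
  Equitable f × (∀ (i : Fin t) → InducesForest G (λ v → f v ≡ i))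

HasEquitableTreeColoring : ∀ {n} → Graph n → ℕ → Set
HasEquitableTreeColoring {n} G t =
  Σ (Fin n → Fin t) λ f → IsEquitableTreeColoring G f

-- va^≡_{∞,∞}(G) = k : k is the smallest positive integer such that G has an
-- equitable t'-tree-colouring for every t' ≥ k.
VaEquals : ∀ {n} → Graph n → ℕ → Set
VaEquals G k =
  1 ≤ k ×
  (∀ t → k ≤ t → HasEquitableTreeColoring G t) ×
  (∀ k' → 1 ≤ k' → k' < k → ¬ (∀ t → k' ≤ t → HasEquitableTreeColoring G t))

-- Every outerplanar graph on at least two vertices has vertices x ≠ y such that x has at most one
-- neighbour besides y, and y at most three besides x: draw the graph convexly and look just inside
-- an innermost chord spanning at least three steps. Colour by induction on the number of vertices:
-- remove a batch of t vertices, namely such a pair followed by t − 2 vertices each of which has at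
-- most three neighbours among the vertices left (or everything, if fewer remain), and colour the
-- rest. The batch then gets t distinct colours: each batch vertex other than x avoids the at most one
-- colour repeated among its neighbours outside the batch, and x, having at most one such neighbour,
-- takes the last colour. Each class grows by exactly one vertex (or the rest was empty), so the
-- colouring stays equitable; and every vertex has at most one neighbour of its own colour removed
-- after it, so no colour class contains a cycle: its earliest-removed vertex would have two.

module Submission where

open import Defs
open import Data.Bool using (Bool; true; false; _∧_; _∨_; not; if_then_else_)
open import Data.Bool.Properties as Bool using (∧-zeroʳ; ∧-identityʳ; ∧-conicalˡ; ∧-conicalʳ; ∨-identityʳ)
open import Data.Empty using (⊥; ⊥-elim)
open import Data.Fin using (Fin; zero; suc; toℕ; fromℕ<; _≟_)
import Data.Fin.Properties as Fin
open import Data.List using (List; []; _∷_; [_]; _++_; length; map; foldl; filter; tabulate)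
open import Data.List.Extrema.Nat using (argmin; argmin-sel; f[argmin]≤f[⊤]; f[argmin]≤f[xs])
open import Data.List.Membership.Propositional using (_∈_; _∉_)
open import Data.List.Membership.Propositional.Properties
  using (∈-tabulate⁺; ∈-filter⁺; ∈-filter⁻; ∈-∃++; ∈-map⁺; ∈-map⁻)
open import Data.List.Properties using (++-assoc; length-++; length-map)
open import Data.List.Relation.Unary.All as All using (All; []; _∷_)
open import Data.List.Relation.Unary.All.Properties using (All¬⇒¬Any; map⁺; ++⁺)
open import Data.List.Relation.Unary.AllPairs as AllPairs using (AllPairs; []; _∷_)
import Data.List.Relation.Unary.AllPairs.Properties as AllPairsₚ
open import Data.List.Relation.Unary.Any using (here; there; any?)
open import Data.List.Relation.Unary.Unique.Propositional using (Unique)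
open import Data.Maybe using (Maybe; just; nothing; fromMaybe)
open import Data.Maybe.Properties using (just-injective)
open import Data.Nat using (ℕ; zero; suc; _+_; _∸_; _≤_; _<_; _≤?_; _<?_; z≤n; s≤s)
open import Data.Nat.Properties hiding (_≟_)
open import Data.Product using (∃; ∃₂; _×_; _,_; proj₁; proj₂)
open import Data.Sum using (_⊎_; inj₁; inj₂)
import Data.Sum as Sum
open import Data.Unit using (tt)
open import Data.Vec.Functional using (updateAt)
open import Data.Vec.Functional.Properties using (updateAt-updates; updateAt-minimal)
open import Function using (_∘_; Inverse; const; case_of_)
open import Relation.Binary.Definitions using (DecidableEquality; tri<; tri≈; tri>)
open import Relation.Binary.PropositionalEquality hiding ([_])
open import Relation.Nullary using (Dec; yes; no; does; ¬_; _×-dec_)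
open import Relation.Nullary.Decidable as Dec using (dec-true; dec-false)

private variable
  n t : ℕ
  A : Set

-- Vertex sets as Boolean predicates

count : (Fin n → Bool) → ℕ
count {zero}  P = 0
count {suc n} P = if P zero then suc (count (P ∘ suc)) else count (P ∘ suc)

_==_ : Fin n → Fin n → Bool
u == v = does (u ≟ v)

_∈?_ : (v : Fin n) (L : List (Fin n)) → Dec (v ∈ L)
v ∈? L = any? (v ≟_) L

_-_ : (Fin n → Bool) → Fin n → Fin n → Bool
(X - z) v = X v ∧ not (v == z)

-- Removing one vertex at a time makes X ∖ (z ∷ zs) definitionally (X ∖ [ z ]) ∖ zs.
_∖_ : (Fin n → Bool) → List (Fin n) → Fin n → Bool
X ∖ L = foldl _-_ X L

TwoDistinct : {A : Set} → (A → Set) → Set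
TwoDistinct P = ∃₂ λ u v → u ≢ v × P u × P v

AtMost₁ : {A : Set} → (A → Set) → Set
AtMost₁ P = ∃ λ a → ∀ {u} → P u → u ≡ a

AtMost₃ : {A : Set} → (A → Set) → Set
AtMost₃ P = ∃ λ a → ∃ λ b → ∃ λ c → ∀ {u} → P u → u ≡ a ⊎ u ≡ b ⊎ u ≡ c

==-refl : (v : Fin n) → (v == v) ≡ true
==-refl v = dec-true (v ≟ v) refl

==⇒≡ : {u v : Fin n} → (u == v) ≡ true → u ≡ v
==⇒≡ {u = u} {v} eq with u ≟ v
... | yes u≡v = u≡v

count-cong : {P Q : Fin n → Bool} → (∀ v → P v ≡ Q v) → count P ≡ count Q
count-cong {zero}  eq = refl
count-cong {suc n} {P} {Q} eq
  rewrite eq zero | count-cong {P = P ∘ suc} {Q ∘ suc} (eq ∘ suc) = refl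

count-≤ : (P : Fin n → Bool) → count P ≤ n
count-≤ {zero}  P = z≤n
count-≤ {suc n} P with P zero
... | true  = s≤s (count-≤ (P ∘ suc))
... | false = m≤n⇒m≤1+n (count-≤ (P ∘ suc))

none⇒count≡0 : (P : Fin n → Bool) → (∀ v → P v ≡ false) → count P ≡ 0
none⇒count≡0 {zero}  P none = refl
none⇒count≡0 {suc n} P none rewrite none zero = none⇒count≡0 (P ∘ suc) (none ∘ suc)

count-mono : {P Q : Fin n → Bool} → (∀ v → P v ≡ true → Q v ≡ true) → count P ≤ count Q
count-mono {zero}  sub = z≤n
count-mono {suc n} {P} {Q} sub with P zero in p | Q zero in q
... | true  | true  = s≤s (count-mono (sub ∘ suc))
... | true  | false = ⊥-elim (case trans (sym (sub zero p)) q of λ ())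
... | false | true  = m≤n⇒m≤1+n (count-mono (sub ∘ suc))
... | false | false = count-mono (sub ∘ suc)

count-mono-< : {P Q : Fin n → Bool} → (∀ v → P v ≡ true → Q v ≡ true) →
  ∀ w → P w ≡ false → Q w ≡ true → count P < count Q
count-mono-< {suc n} {P} {Q} sub zero p q rewrite p | q = s≤s (count-mono (sub ∘ suc))
count-mono-< {suc n} {P} {Q} sub (suc w) p q with P zero in p₀ | Q zero in q₀
... | true  | true  = s≤s (count-mono-< (sub ∘ suc) w p q)
... | true  | false = ⊥-elim (case trans (sym (sub zero p₀)) q₀ of λ ())
... | false | true  = m≤n⇒m≤1+n (count-mono-< (sub ∘ suc) w p q)
... | false | false = count-mono-< (sub ∘ suc) w p q

count-∨+count-∧ : (P Q : Fin n → Bool) →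
  count (λ v → P v ∨ Q v) + count (λ v → P v ∧ Q v) ≡ count P + count Q
count-∨+count-∧ {zero}  P Q = refl
count-∨+count-∧ {suc n} P Q with P zero | Q zero | count-∨+count-∧ (P ∘ suc) (Q ∘ suc)
... | true  | true  | ih = cong suc (trans (+-suc _ _) (trans (cong suc ih) (sym (+-suc _ _))))
... | true  | false | ih = cong suc ih
... | false | true  | ih = trans (cong suc ih) (sym (+-suc _ _))
... | false | false | ih = ih

count-∨-disjoint : (P Q : Fin n → Bool) → (∀ v → P v ∧ Q v ≡ false) →
  count (λ v → P v ∨ Q v) ≡ count P + count Q
count-∨-disjoint P Q disjoint = begin
  count (λ v → P v ∨ Q v)                                 ≡⟨ +-identityʳ _ ⟨
  count (λ v → P v ∨ Q v) + 0                             ≡⟨ cong (count (λ v → P v ∨ Q v) +_) (none⇒count≡0 _ disjoint) ⟨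
  count (λ v → P v ∨ Q v) + count (λ v → P v ∧ Q v)       ≡⟨ count-∨+count-∧ P Q ⟩
  count P + count Q                                       ∎
  where open ≡-Reasoning

count-∨-≤ : (P Q : Fin n → Bool) → count (λ v → P v ∨ Q v) ≤ count P + count Q
count-∨-≤ P Q = ≤-trans (m≤m+n _ _) (≤-reflexive (count-∨+count-∧ P Q))

count-singleton : (w : Fin n) → count (_== w) ≡ 1
count-singleton {suc n} zero    = cong suc (none⇒count≡0 {n} (λ v → suc v == zero) (λ _ → refl))
count-singleton {suc n} (suc w) = count-singleton w

member⇒0<count : (P : Fin n → Bool) {v : Fin n} → P v ≡ true → 0 < count P
member⇒0<count P {v} p = ≤-trans (≤-reflexive (sym (count-singleton v)))
  (count-mono {P = _== v} {Q = P} (λ u eq → subst (λ w → P w ≡ true) (sym (==⇒≡ eq)) p))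

0<count⇒member : (P : Fin n → Bool) → 0 < count P → ∃ λ v → P v ≡ true
0<count⇒member {suc n} P pos with P zero in p
... | true  = zero , p
... | false with 0<count⇒member (P ∘ suc) pos
...   | v , q = suc v , q

count<n⇒nonMember : (P : Fin n → Bool) → count P < n → ∃ λ v → P v ≡ false
count<n⇒nonMember {suc n} P lt with P zero in p
... | false = zero , p
... | true with count<n⇒nonMember (P ∘ suc) (≤-pred lt)
...   | v , q = suc v , q

count≡n⇒all : (P : Fin n → Bool) → count P ≡ n → ∀ v → P v ≡ true
count≡n⇒all {suc n} P full v with P zero in p
count≡n⇒all {suc n} P full zero    | true = p
count≡n⇒all {suc n} P full (suc v) | true = count≡n⇒all (P ∘ suc) (suc-injective full) v
... | false = ⊥-elim (<-irrefl full (s≤s (count-≤ (P ∘ suc))))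

TwoDistinct⇒2≤count : (P : Fin n → Bool) → TwoDistinct (λ v → P v ≡ true) → 2 ≤ count P
TwoDistinct⇒2≤count {suc n} P (zero  , zero  , u≢v , _ , _) = ⊥-elim (u≢v refl)
TwoDistinct⇒2≤count {suc n} P (zero  , suc v , _ , p , q) rewrite p = s≤s (member⇒0<count (P ∘ suc) q)
TwoDistinct⇒2≤count {suc n} P (suc u , zero  , _ , p , q) rewrite q = s≤s (member⇒0<count (P ∘ suc) p)
TwoDistinct⇒2≤count {suc n} P (suc u , suc v , u≢v , p , q) with P zero
... | true  = m≤n⇒m≤1+n (TwoDistinct⇒2≤count (P ∘ suc) (u , v , u≢v ∘ cong suc , p , q))
... | false = TwoDistinct⇒2≤count (P ∘ suc) (u , v , u≢v ∘ cong suc , p , q)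

2≤count⇒TwoDistinct : (P : Fin n → Bool) → 2 ≤ count P → TwoDistinct (λ v → P v ≡ true)
2≤count⇒TwoDistinct {suc n} P two with P zero in p
... | true with 0<count⇒member (P ∘ suc) (≤-pred two)
...   | v , q = zero , suc v , (λ ()) , p , q
2≤count⇒TwoDistinct {suc n} P two | false with 2≤count⇒TwoDistinct (P ∘ suc) two
...   | u , v , u≢v , q₁ , q₂ = suc u , suc v , u≢v ∘ Fin.suc-injective , q₁ , q₂

count-∈?-≤ : (cs : List (Fin n)) → count (λ c → does (c ∈? cs)) ≤ length cs
count-∈?-≤ {n} []   = ≤-reflexive (none⇒count≡0 {n} _ (λ _ → refl))
count-∈?-≤ (d ∷ ds) = begin
  count (λ c → (c == d) ∨ does (c ∈? ds))  ≤⟨ count-∨-≤ (_== d) (λ c → does (c ∈? ds)) ⟩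
  count (_== d) + count (λ c → does (c ∈? ds))  ≤⟨ +-mono-≤ (≤-reflexive (count-singleton d)) (count-∈?-≤ ds) ⟩
  suc (length ds)  ∎
  where open ≤-Reasoning

count-∈?-unique : {cs : List (Fin n)} → Unique cs → count (λ c → does (c ∈? cs)) ≡ length cs
count-∈?-unique {n} {[]} _ = none⇒count≡0 {n} _ (λ _ → refl)
count-∈?-unique {cs = d ∷ ds} (d∉ds ∷ uds) = begin
  count (λ c → (c == d) ∨ does (c ∈? ds))  ≡⟨ count-∨-disjoint (_== d) (λ c → does (c ∈? ds)) disjoint ⟩
  count (_== d) + count (λ c → does (c ∈? ds))  ≡⟨ cong₂ _+_ (count-singleton d) (count-∈?-unique uds) ⟩
  suc (length ds)  ∎
  where
  open ≡-Reasoning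
  disjoint : ∀ c → (c == d) ∧ does (c ∈? ds) ≡ false
  disjoint c with c ≟ d
  ... | yes refl = dec-false (c ∈? ds) (All¬⇒¬Any d∉ds)
  ... | no _     = refl

∖-⊆ : (X : Fin n → Bool) (L : List (Fin n)) {v : Fin n} → (X ∖ L) v ≡ true → X v ≡ true
∖-⊆ X []       v∈ = v∈
∖-⊆ X (z ∷ zs) v∈ = ∧-conicalˡ _ _ (∖-⊆ (X - z) zs v∈)

∖-false : (X : Fin n → Bool) (L : List (Fin n)) {v : Fin n} → X v ≡ false → (X ∖ L) v ≡ false
∖-false X []       v∉ = v∉
∖-false X (z ∷ zs) v∉ = ∖-false (X - z) zs (cong (_∧ _) v∉)

∖-∈ : (X : Fin n → Bool) {L : List (Fin n)} {v : Fin n} → v ∈ L → (X ∖ L) v ≡ false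
∖-∈ X {z ∷ zs} (here refl) = ∖-false (X - z) zs (trans (cong (λ b → X z ∧ not b) (==-refl z)) (∧-zeroʳ (X z)))
∖-∈ X {z ∷ zs} (there v∈zs) = ∖-∈ (X - z) v∈zs

∖-∉ : (X : Fin n → Bool) {L : List (Fin n)} {v : Fin n} → v ∉ L → (X ∖ L) v ≡ X v
∖-∉ X {[]}     v∉L = refl
∖-∉ X {z ∷ zs} {v} v∉L = begin
  ((X - z) ∖ zs) v     ≡⟨ ∖-∉ (X - z) (v∉L ∘ there) ⟩
  X v ∧ not (v == z)   ≡⟨ cong (λ b → X v ∧ not b) (dec-false (v ≟ z) (v∉L ∘ here)) ⟩
  X v ∧ true           ≡⟨ ∧-identityʳ (X v) ⟩
  X v                  ∎
  where open ≡-Reasoning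

∖-∉⁻ : (X : Fin n → Bool) {L : List (Fin n)} {v : Fin n} → (X ∖ L) v ≡ true → v ∉ L
∖-∉⁻ X v∈ v∈L with trans (sym v∈) (∖-∈ X v∈L)
... | ()

count<2⇒∖-empty : (Q : Fin n → Bool) {z u : Fin n} → Q z ≡ true → ¬ 2 ≤ count Q → (Q ∖ (z ∷ [])) u ≡ true → ⊥
count<2⇒∖-empty Q {z} {u} z∈Q ¬two u∈ =
  ¬two (TwoDistinct⇒2≤count Q (u , z , (λ u≡z → ∖-∉⁻ Q {z ∷ []} u∈ (here u≡z)) , ∖-⊆ Q (z ∷ []) u∈ , z∈Q))

does-∈?⇒∈ : {v : Fin n} {L : List (Fin n)} → does (v ∈? L) ≡ true → v ∈ L
does-∈?⇒∈ {v = v} {L} eq with v ∈? L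
... | yes v∈L = v∈L

module _ {A : Set} {P Q : A → Set} where

  AtMost₁-mono : (∀ {u} → P u → Q u) → AtMost₁ Q → AtMost₁ P
  AtMost₁-mono P⊆Q (a , onlyA) = a , onlyA ∘ P⊆Q

  AtMost₃-mono : (∀ {u} → P u → Q u) → AtMost₃ Q → AtMost₃ P
  AtMost₃-mono P⊆Q (a , b , c , amongABC) = a , b , c , amongABC ∘ P⊆Q

TwoDistinct-map : {A : Set} {P Q : A → Set} → (∀ {u} → P u → Q u) → TwoDistinct P → TwoDistinct Q
TwoDistinct-map P⊆Q (u , v , u≢v , pu , pv) = u , v , u≢v , P⊆Q pu , P⊆Q pv

AtMost₁⇒¬TwoDistinct : {A : Set} {P : A → Set} → AtMost₁ P → ¬ TwoDistinct P
AtMost₁⇒¬TwoDistinct (a , onlyA) (u , v , u≢v , pu , pv) = u≢v (trans (onlyA pu) (sym (onlyA pv)))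

module _ {C : Set} (_≟ᶜ_ : DecidableEquality C) where

  repeated : C → C → C → C
  repeated ca cb cc with ca ≟ᶜ cb | ca ≟ᶜ cc
  ... | yes _ | _     = ca
  ... | no _  | yes _ = ca
  ... | no _  | no _  = cb

  repeated-ab : ∀ {ca cb cc col} → ca ≡ col → cb ≡ col → col ≡ repeated ca cb cc
  repeated-ab {ca} {cb} {cc} refl refl with ca ≟ᶜ ca
  ... | yes _  = refl
  ... | no ≢ca = ⊥-elim (≢ca refl)

  repeated-ac : ∀ {ca cb cc col} → ca ≡ col → cc ≡ col → col ≡ repeated ca cb cc
  repeated-ac {ca} {cb} {cc} refl refl with ca ≟ᶜ cb | ca ≟ᶜ ca
  ... | yes _ | _      = refl
  ... | no _  | yes _  = refl
  ... | no _  | no ≢ca = ⊥-elim (≢ca refl)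

  repeated-bc : ∀ {ca cb cc col} → cb ≡ col → cc ≡ col → col ≡ repeated ca cb cc
  repeated-bc {ca} {cb} {cc} refl refl with ca ≟ᶜ cb
  ... | yes ca≡cb = sym ca≡cb
  ... | no _      = refl

  AtMost₃⇒AtMost₁-repeatedColour : {A : Set} {P : A → Set} (g : A → C) → AtMost₃ P →
    AtMost₁ (λ col → TwoDistinct (λ u → P u × g u ≡ col))
  AtMost₃⇒AtMost₁-repeatedColour g (a , b , c , amongABC) =
    repeated (g a) (g b) (g c) ,
    λ (u , v , u≢v , (pu , gu) , (pv , gv)) → shared (amongABC pu) (amongABC pv) u≢v gu gv
    where
    shared : ∀ {u v col} → (u ≡ a ⊎ u ≡ b ⊎ u ≡ c) → (v ≡ a ⊎ v ≡ b ⊎ v ≡ c) → u ≢ v →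
      g u ≡ col → g v ≡ col → col ≡ repeated (g a) (g b) (g c)
    shared (inj₁ refl)        (inj₁ refl)        u≢v _ _ = ⊥-elim (u≢v refl)
    shared (inj₂ (inj₁ refl)) (inj₂ (inj₁ refl)) u≢v _ _ = ⊥-elim (u≢v refl)
    shared (inj₂ (inj₂ refl)) (inj₂ (inj₂ refl)) u≢v _ _ = ⊥-elim (u≢v refl)
    shared (inj₁ refl)        (inj₂ (inj₁ refl)) _ gu gv = repeated-ab gu gv
    shared (inj₂ (inj₁ refl)) (inj₁ refl)        _ gu gv = repeated-ab gv gu
    shared (inj₁ refl)        (inj₂ (inj₂ refl)) _ gu gv = repeated-ac gu gv
    shared (inj₂ (inj₂ refl)) (inj₁ refl)        _ gu gv = repeated-ac gv gu
    shared (inj₂ (inj₁ refl)) (inj₂ (inj₂ refl)) _ gu gv = repeated-bc gu gv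
    shared (inj₂ (inj₂ refl)) (inj₂ (inj₁ refl)) _ gu gv = repeated-bc gv gu

-- Non-crossing relations on ℕ

module NonCrossing
  (_~_ : ℕ → ℕ → Set) (_~?_ : ∀ a b → Dec (a ~ b))
  (~-sym : ∀ {a b} → a ~ b → b ~ a)
  (~-nonCrossing : ∀ {a b c d} → a ~ b → c ~ d → a < c → c < b → b < d → ⊥) where

  record LightPairBetween (lo hi : ℕ) : Set where
    field
      x y     : ℕ
      lo<x    : lo < x
      x<hi    : x < hi
      lo<y    : lo < y
      y<hi    : y < hi
      x≢y     : x ≢ y
      x-light : AtMost₁ (λ u → u ≢ x × u ≢ y × x ~ u)
      y-light : AtMost₃ (λ u → u ≢ x × u ≢ y × y ~ u)

  widen : ∀ {lo hi lo′ hi′} → lo ≤ lo′ → hi′ ≤ hi → LightPairBetween lo′ hi′ → LightPairBetween lo hi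
  widen lo≤ ≤hi p = record
    { x = x ; y = y ; lo<x = ≤-<-trans lo≤ lo<x ; x<hi = <-≤-trans x<hi ≤hi
    ; lo<y = ≤-<-trans lo≤ lo<y ; y<hi = <-≤-trans y<hi ≤hi
    ; x≢y = x≢y ; x-light = x-light ; y-light = y-light }
    where open LightPairBetween p

  Confined : ℕ → ℕ → Set
  Confined lo hi = ∀ {w u} → lo < w → w < hi → w ~ u → lo ≤ u × u ≤ hi

  LongChord : ℕ → ℕ → ℕ → ℕ → Set
  LongChord lo hi c d = lo < c × c + 3 ≤ d × d ≤ hi × c ~ d

  longChord? : ∀ lo hi → Dec (∃₂ (LongChord lo hi))
  longChord? lo hi = Dec.map′
    (λ (c , _ , d , _ , chord) → c , d , chord)
    (λ (c , d , chord@(_ , c+3≤d , d≤hi , _)) →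
      c , s≤s (≤-trans (m≤m+n c 3) (≤-trans c+3≤d d≤hi)) , d , s≤s d≤hi , chord)
    (anyUpTo? (λ c → anyUpTo? (λ d → longChord-at? c d) (suc hi)) (suc hi))
    where
    longChord-at? : ∀ c d → Dec (LongChord lo hi c d)
    longChord-at? c d = (suc lo ≤? c) ×-dec (c + 3 ≤? d) ×-dec (d ≤? hi) ×-dec (c ~? d)

  -- An edge from inside (c, d) to outside [c, d] would cross the chord.
  chord-confines : ∀ {c d} → c ~ d → Confined c d
  chord-confines {c} {d} c~d {w} {u} c<w w<d w~u with c ≤? u | u ≤? d
  ... | yes c≤u | yes u≤d = c≤u , u≤d
  ... | no c≰u  | _       = ⊥-elim (~-nonCrossing (~-sym w~u) c~d (≰⇒> c≰u) c<w w<d)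
  ... | yes _   | no u≰d  = ⊥-elim (~-nonCrossing c~d w~u c<w w<d (≰⇒> u≰d))

  module WithoutLongChords {lo hi : ℕ} (wide : lo + 3 ≤ hi) (confined : Confined lo hi)
    (noLongChord : ¬ ∃₂ (LongChord lo hi)) where

    step : ∀ k → lo + k < lo + suc k
    step k = +-monoʳ-< lo (n<1+n k)

    lo+k<hi : ∀ {k} → k < 3 → lo + k < hi
    lo+k<hi k<3 = <-≤-trans (+-monoʳ-< lo k<3) wide

    lo+k≢lo+l : ∀ {k l} → k ≢ l → lo + k ≢ lo + l
    lo+k≢lo+l k≢l = k≢l ∘ +-cancelˡ-≡ lo _ _

    offset : ∀ {i u} → 0 < i → lo + i < hi → (lo + i) ~ u → ∃ λ δ → u ≡ lo + δ × δ ≤ i + 2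
    offset {i} {u} 0<i lo+i<hi lo+i~u with confined (m<m+n lo 0<i) lo+i<hi lo+i~u
    ... | lo≤u , u≤hi with u ∸ lo ≤? i + 2
    ...   | yes short = u ∸ lo , sym (m+[n∸m]≡n lo≤u) , short
    ...   | no long   = ⊥-elim (noLongChord (lo + i , u , m<m+n lo 0<i , reach , u≤hi , lo+i~u))
      where
      reach : lo + i + 3 ≤ u
      reach = begin
        lo + i + 3         ≡⟨ +-assoc lo i 3 ⟩
        lo + (i + 3)       ≡⟨ cong (lo +_) (+-suc i 2) ⟩
        lo + suc (i + 2)   ≤⟨ +-monoʳ-≤ lo (≰⇒> long) ⟩
        lo + (u ∸ lo)      ≡⟨ m+[n∸m]≡n lo≤u ⟩
        u                  ∎
        where open ≤-Reasoning

    private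
      x≢y : lo + 1 ≢ lo + 2
      x≢y = lo+k≢lo+l (λ ())

      lo<lo+ : ∀ {k} → 0 < k → lo < lo + k
      lo<lo+ = m<m+n lo

    lightPair : LightPairBetween lo hi
    lightPair with (lo + 1) ~? (lo + 3)
    ... | no ¬1~3 = record
      { x = lo + 1 ; y = lo + 2 ; lo<x = lo<lo+ (s≤s z≤n) ; x<hi = lo+k<hi (s≤s (s≤s z≤n))
      ; lo<y = lo<lo+ (s≤s z≤n) ; y<hi = lo+k<hi (s≤s (s≤s (s≤s z≤n))) ; x≢y = x≢y
      ; x-light = lo , light₁ ; y-light = lo , lo + 3 , lo + 4 , light₃ }
      where
      light₁ : ∀ {u} → u ≢ lo + 1 × u ≢ lo + 2 × (lo + 1) ~ u → u ≡ lo
      light₁ (≢x , ≢y , 1~u) with offset (s≤s z≤n) (lo+k<hi (s≤s (s≤s z≤n))) 1~u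
      ... | 0 , refl , _ = +-identityʳ lo
      ... | 1 , refl , _ = ⊥-elim (≢x refl)
      ... | 2 , refl , _ = ⊥-elim (≢y refl)
      ... | 3 , refl , _ = ⊥-elim (¬1~3 1~u)
      ... | suc (suc (suc (suc _))) , _ , s≤s (s≤s (s≤s ()))
      light₃ : ∀ {u} → u ≢ lo + 1 × u ≢ lo + 2 × (lo + 2) ~ u → u ≡ lo ⊎ u ≡ lo + 3 ⊎ u ≡ lo + 4
      light₃ (≢x , ≢y , 2~u) with offset (s≤s z≤n) (lo+k<hi (s≤s (s≤s (s≤s z≤n)))) 2~u
      ... | 0 , refl , _ = inj₁ (+-identityʳ lo)
      ... | 1 , refl , _ = ⊥-elim (≢x refl)
      ... | 2 , refl , _ = ⊥-elim (≢y refl)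
      ... | 3 , refl , _ = inj₂ (inj₁ refl)
      ... | 4 , refl , _ = inj₂ (inj₂ refl)
      ... | suc (suc (suc (suc (suc _)))) , _ , s≤s (s≤s (s≤s (s≤s ())))
    ... | yes 1~3 = record
      { x = lo + 2 ; y = lo + 1 ; lo<x = lo<lo+ (s≤s z≤n) ; x<hi = lo+k<hi (s≤s (s≤s (s≤s z≤n)))
      ; lo<y = lo<lo+ (s≤s z≤n) ; y<hi = lo+k<hi (s≤s (s≤s z≤n)) ; x≢y = x≢y ∘ sym
      ; x-light = lo + 3 , light₁ ; y-light = lo , lo + 3 , lo + 3 , light₃ }
      where
      -- The chord (lo + 1, lo + 3) cuts lo + 2 off from lo and from lo + 4.
      light₁ : ∀ {u} → u ≢ lo + 2 × u ≢ lo + 1 × (lo + 2) ~ u → u ≡ lo + 3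
      light₁ (≢x , ≢y , 2~u) with offset (s≤s z≤n) (lo+k<hi (s≤s (s≤s (s≤s z≤n)))) 2~u
      ... | 0 , refl , _ = ⊥-elim (~-nonCrossing (~-sym 2~u) 1~3 (step 0) (step 1) (step 2))
      ... | 1 , refl , _ = ⊥-elim (≢y refl)
      ... | 2 , refl , _ = ⊥-elim (≢x refl)
      ... | 3 , refl , _ = refl
      ... | 4 , refl , _ = ⊥-elim (~-nonCrossing 1~3 2~u (step 1) (step 2) (step 3))
      ... | suc (suc (suc (suc (suc _)))) , _ , s≤s (s≤s (s≤s (s≤s ())))
      light₃ : ∀ {u} → u ≢ lo + 2 × u ≢ lo + 1 × (lo + 1) ~ u → u ≡ lo ⊎ u ≡ lo + 3 ⊎ u ≡ lo + 3
      light₃ (≢x , ≢y , 1~u) with offset (s≤s z≤n) (lo+k<hi (s≤s (s≤s z≤n))) 1~u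
      ... | 0 , refl , _ = inj₁ (+-identityʳ lo)
      ... | 1 , refl , _ = ⊥-elim (≢y refl)
      ... | 2 , refl , _ = ⊥-elim (≢x refl)
      ... | 3 , refl , _ = inj₂ (inj₁ refl)
      ... | suc (suc (suc (suc _))) , _ , s≤s (s≤s (s≤s ()))

  lightPair : ∀ fuel {lo hi} → hi ≤ fuel + lo → lo + 3 ≤ hi → Confined lo hi → LightPairBetween lo hi
  lightPair zero       {lo} hi≤lo wide _ = ⊥-elim (<⇒≱ (<-≤-trans (m<m+n lo (s≤s z≤n)) wide) hi≤lo)
  lightPair (suc fuel) {lo} {hi} hi≤ wide confined with longChord? lo hi
  ... | no noLongChord = WithoutLongChords.lightPair wide confined noLongChord
  ... | yes (c , d , lo<c , c+3≤d , d≤hi , c~d) =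
    widen (<⇒≤ lo<c) d≤hi (lightPair fuel d≤fuel+c c+3≤d (chord-confines c~d))
    where
    d≤fuel+c : d ≤ fuel + c
    d≤fuel+c = ≤-trans d≤hi (≤-trans hi≤ (≤-trans (≤-reflexive (sym (+-suc fuel lo))) (+-monoʳ-≤ fuel lo<c)))

-- Light pairs in outerplanar graphs

nth : List A → ℕ → Maybe A
nth []       k       = nothing
nth (a ∷ as) zero    = just a
nth (a ∷ as) (suc k) = nth as k

nth-∈ : ∀ (xs : List A) k {a} → nth xs k ≡ just a → a ∈ xs
nth-∈ (x ∷ xs) zero    refl = here refl
nth-∈ (x ∷ xs) (suc k) eq   = there (nth-∈ xs k eq)

∈⇒nth : ∀ {xs : List A} {a} → a ∈ xs → ∃ λ k → nth xs k ≡ just a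
∈⇒nth (here refl) = zero , refl
∈⇒nth (there a∈xs) with ∈⇒nth a∈xs
... | k , eq = suc k , eq

nth-< : ∀ (xs : List A) k {a} → nth xs k ≡ just a → k < length xs
nth-< (x ∷ xs) zero    eq = s≤s z≤n
nth-< (x ∷ xs) (suc k) eq = s≤s (nth-< xs k eq)

<⇒nth : ∀ (xs : List A) k → k < length xs → ∃ λ a → nth xs k ≡ just a
<⇒nth (x ∷ xs) zero    _          = x , refl
<⇒nth (x ∷ xs) (suc k) (s≤s k<len) = <⇒nth xs k k<len

nth-sorted : ∀ {_R_ : A → A → Set} {xs : List A} → AllPairs _R_ xs →
  ∀ {k l a b} → nth xs k ≡ just a → nth xs l ≡ just b → k < l → a R b
nth-sorted {xs = x ∷ xs} (x<xs ∷ _)     {zero}  {suc l} refl eq _ = All.lookup x<xs (nth-∈ xs l eq)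
nth-sorted {xs = x ∷ xs} (_ ∷ xs-sorted) {suc k} {suc l} eq₁ eq₂ (s≤s k<l) =
  nth-sorted xs-sorted eq₁ eq₂ k<l

∈⇒0<length : ∀ {xs : List A} {a} → a ∈ xs → 0 < length xs
∈⇒0<length (here _)  = s≤s z≤n
∈⇒0<length (there _) = s≤s z≤n

distinct∈⇒2≤length : ∀ {xs : List A} {a b} → a ∈ xs → b ∈ xs → a ≢ b → 2 ≤ length xs
distinct∈⇒2≤length (here refl) (here refl) a≢b = ⊥-elim (a≢b refl)
distinct∈⇒2≤length (here _)    (there b∈) _   = s≤s (∈⇒0<length b∈)
distinct∈⇒2≤length (there a∈)  (here _)   _   = s≤s (∈⇒0<length a∈)
distinct∈⇒2≤length (there a∈)  (there b∈) a≢b = m≤n⇒m≤1+n (distinct∈⇒2≤length a∈ b∈ a≢b)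

NeighboursIn : Graph n → (Fin n → Bool) → Fin n → Fin n → Set
NeighboursIn G X w u = X u ≡ true × Adj G w u

record LightPair (G : Graph n) (R : Fin n → Bool) : Set where
  field
    x y     : Fin n
    x∈R     : R x ≡ true
    y∈R     : R y ≡ true
    x≢y     : x ≢ y
    x-light : AtMost₁ (NeighboursIn G (R ∖ (x ∷ y ∷ [])) x)
    y-light : AtMost₃ (NeighboursIn G (R ∖ (x ∷ y ∷ [])) y)

AdjAt : Graph n → Maybe (Fin n) → Maybe (Fin n) → Set
AdjAt G (just a) (just b) = Adj G a b
AdjAt G _        _        = ⊥

AdjAt-just : ∀ {G : Graph n} {ma mb} → AdjAt G ma mb →
  ∃ λ a → ∃ λ b → ma ≡ just a × mb ≡ just b × Adj G a b
AdjAt-just {ma = just a} {just b} a~b = a , b , refl , refl , a~b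

module _ {G : Graph n} (outerplanar : Outerplanar G) (R : Fin n → Bool) where

  private
    open Inverse (proj₁ outerplanar) using (to; from; strictlyInverseˡ; strictlyInverseʳ)

    p : Fin n → ℕ
    p v = toℕ (to v)

    inR? : ∀ v → Dec (R v ≡ true)
    inR? v = R v Bool.≟ true

    Rs : List (Fin n)
    Rs = filter inR? (tabulate from)

    Rs-sorted : AllPairs (λ u v → p u < p v) Rs
    Rs-sorted = AllPairsₚ.filter⁺ inR? (AllPairsₚ.tabulate⁺-< λ {i} {j} i<j →
      subst₂ _<_ (sym (cong toℕ (strictlyInverseˡ i))) (sym (cong toℕ (strictlyInverseˡ j))) i<j)

    ∈Rs : ∀ {v} → R v ≡ true → v ∈ Rs
    ∈Rs {v} v∈R = ∈-filter⁺ inR? (subst (_∈ tabulate from) (strictlyInverseʳ v) (∈-tabulate⁺ (to v))) v∈R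

    -- Vertices of R are ranked 1, 2, …, length Rs by position; rank 0 is left empty.
    at : ℕ → Maybe (Fin n)
    at zero    = nothing
    at (suc k) = nth Rs k

    at⇒R : ∀ {k v} → at k ≡ just v → R v ≡ true
    at⇒R {suc k} eq = proj₂ (∈-filter⁻ inR? {xs = tabulate from} (nth-∈ Rs k eq))

    R⇒at : ∀ {v} → R v ≡ true → ∃ λ k → at k ≡ just v
    R⇒at v∈R with ∈⇒nth (∈Rs v∈R)
    ... | k , eq = suc k , eq

    at-sorted : ∀ {k l a b} → at k ≡ just a → at l ≡ just b → k < l → p a < p b
    at-sorted {suc k} {suc l} eq₁ eq₂ (s≤s k<l) = nth-sorted Rs-sorted eq₁ eq₂ k<l

    at-injective : ∀ {k l v} → at k ≡ just v → at l ≡ just v → k ≡ l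
    at-injective {k} {l} eq₁ eq₂ with <-cmp k l
    ... | tri< k<l _ _ = ⊥-elim (<-irrefl refl (at-sorted eq₁ eq₂ k<l))
    ... | tri≈ _ k≡l _ = k≡l
    ... | tri> _ _ l<k = ⊥-elim (<-irrefl refl (at-sorted eq₂ eq₁ l<k))

    at-bounded : ∀ {k v} → at k ≡ just v → k ≤ length Rs
    at-bounded {suc k} eq = nth-< Rs k eq

    _~_ : ℕ → ℕ → Set
    k ~ l = AdjAt G (at k) (at l)

    _~?_ : ∀ k l → Dec (k ~ l)
    k ~? l with at k | at l
    ... | just a  | just b  = adj G a b Bool.≟ true
    ... | just _  | nothing = no λ ()
    ... | nothing | _       = no λ ()

    ~-sym : ∀ {k l} → k ~ l → l ~ k
    ~-sym k~l with AdjAt-just k~l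
    ... | a , b , eq₁ , eq₂ , a~b rewrite eq₁ | eq₂ = trans (adj-sym G b a) a~b

    ~-nonCrossing : ∀ {a b c d} → a ~ b → c ~ d → a < c → c < b → b < d → ⊥
    ~-nonCrossing a~b c~d a<c c<b b<d with AdjAt-just a~b | AdjAt-just c~d
    ... | va , vb , ea , eb , va~vb | vc , vd , ec , ed , vc~vd =
      proj₂ outerplanar va vb vc vd va~vb vc~vd
        (at-sorted ea ec a<c , at-sorted ec eb c<b , at-sorted eb ed b<d)

    open NonCrossing _~_ _~?_ (λ {k} {l} → ~-sym {k} {l})
      (λ {a} {b} {c} {d} → ~-nonCrossing {a} {b} {c} {d})

    confined : Confined 0 (suc (length Rs))
    confined _ _ w~u with AdjAt-just w~u
    ... | _ , _ , _ , eq , _ = z≤n , m≤n⇒m≤1+n (at-bounded eq)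

  outerplanar-lightPair : 2 ≤ count R → LightPair G R
  outerplanar-lightPair two =
    fromRanks (lightPair (suc (length Rs)) (≤-reflexive (sym (+-identityʳ _))) (s≤s 2≤length) confined)
    where
    2≤length : 2 ≤ length Rs
    2≤length with 2≤count⇒TwoDistinct R two
    ... | u , v , u≢v , u∈R , v∈R = distinct∈⇒2≤length (∈Rs u∈R) (∈Rs v∈R) u≢v

    fromRanks : LightPairBetween 0 (suc (length Rs)) → LightPair G R
    fromRanks pair = record
      { x = vx ; y = vy ; x∈R = at⇒R {x} at-x ; y∈R = at⇒R {y} at-y
      ; x≢y = λ vx≡vy → x≢y (at-injective {x} {y} at-x (subst (λ v → at y ≡ just v) (sym vx≡vy) at-y))
      ; x-light = vertexAt (proj₁ ranks-x-light) , λ nb →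
          let l , at-l , l≢x , l≢y , x~l = ranked {k = x} at-x nb in
          named {l = l} at-l (proj₂ ranks-x-light (l≢x , l≢y , x~l))
      ; y-light = let a , b , c , amongABC = ranks-y-light in
          vertexAt a , vertexAt b , vertexAt c , λ nb →
          let l , at-l , l≢x , l≢y , y~l = ranked {k = y} at-y nb in
          Sum.map (named {l = l} at-l) (Sum.map (named {l = l} at-l) (named {l = l} at-l)) (amongABC (l≢x , l≢y , y~l))
      }
      where
      open LightPairBetween pair renaming (x-light to ranks-x-light; y-light to ranks-y-light)

      vertex : ∀ {k} → 0 < k → k < suc (length Rs) → ∃ λ v → at k ≡ just v
      vertex {suc k} _ (s≤s k<length) = <⇒nth Rs k k<length

      vx = proj₁ (vertex lo<x x<hi)
      at-x = proj₂ (vertex lo<x x<hi)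
      vy = proj₁ (vertex lo<y y<hi)
      at-y = proj₂ (vertex lo<y y<hi)

      vertexAt : ℕ → Fin n
      vertexAt k = fromMaybe vx (at k)

      named : ∀ {k l u} → at l ≡ just u → l ≡ k → u ≡ vertexAt k
      named at-l refl rewrite at-l = refl

      ranked : ∀ {w k u} → at k ≡ just w → NeighboursIn G (R ∖ (vx ∷ vy ∷ [])) w u →
        ∃ λ l → at l ≡ just u × l ≢ x × l ≢ y × k ~ l
      ranked {u = u} at-k (u∈ , w~u) with R⇒at (∖-⊆ R (vx ∷ vy ∷ []) u∈)
      ... | l , at-l = l , at-l , avoid {x} (here refl) at-x , avoid {y} (there (here refl)) at-y ,
                       subst₂ (AdjAt G) (sym at-k) (sym at-l) w~u
        where
        avoid : ∀ {k v} → v ∈ vx ∷ vy ∷ [] → at k ≡ just v → l ≢ k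
        avoid v∈ at-k′ refl = ∖-∉⁻ R {vx ∷ vy ∷ []} u∈ (subst (_∈ _) (just-injective (trans (sym at-k′) at-l)) v∈)

-- Acyclicity from levels

module _ {n : ℕ} (G : Graph n) where

  Adj-sym : ∀ {u v} → Adj G u v → Adj G v u
  Adj-sym {u} {v} u~v = trans (adj-sym G v u) u~v

  Adj-irrefl : ∀ {u v} → Adj G u v → u ≢ v
  Adj-irrefl {u} u~u refl with trans (sym u~u) (irrefl G u)
  ... | ()

  IsCycleIn : (Fin n → Set) → List (Fin n) → Set
  IsCycleIn P []       = ⊥
  IsCycleIn P (x ∷ xs) =
    2 ≤ length xs × Path G (x ∷ xs) × Adj G (last x xs) x × Unique (x ∷ xs) × All P (x ∷ xs)

  private
    last-++ : ∀ (r : Fin n) rs x → last r (rs ++ [ x ]) ≡ x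
    last-++ r []       x = refl
    last-++ r (s ∷ rs) x = last-++ s rs x

    last-∈ : ∀ (r s : Fin n) rs → last r (s ∷ rs) ∈ s ∷ rs
    last-∈ r s []        = here refl
    last-∈ r s (s′ ∷ rs) = there (last-∈ s s′ rs)

    path-++ : ∀ r rs x → Path G (r ∷ rs) → Adj G (last r rs) x → Path G (r ∷ rs ++ [ x ])
    path-++ r []       x _                    r~x = cons r x [] r~x (single x)
    path-++ r (s ∷ rs) x (cons .r .s .rs r~s p) s~x = cons r s (rs ++ [ x ]) r~s (path-++ s rs x p s~x)

    unique-rotate : ∀ {x : Fin n} {xs} → Unique (x ∷ xs) → Unique (xs ++ [ x ])
    unique-rotate (x∉xs ∷ uxs) = AllPairsₚ.++⁺ uxs ([] ∷ []) (All.map (λ x≢y → (x≢y ∘ sym) ∷ []) x∉xs)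

  rotate : ∀ {P x xs} → IsCycleIn P (x ∷ xs) → IsCycleIn P (xs ++ [ x ])
  rotate {x = x} {r ∷ rs} (2≤ , cons .x .r .rs x~r p , closing , distinct , inP) =
    subst (2 ≤_) (sym (trans (length-++ rs) (+-comm (length rs) 1))) 2≤ ,
    path-++ r rs x p closing ,
    subst (λ z → Adj G z r) (sym (last-++ r rs x)) x~r ,
    unique-rotate distinct ,
    ++⁺ (All.tail inP) (All.head inP ∷ [])

  head-neighbours : ∀ {P y ys} → IsCycleIn P (y ∷ ys) → TwoDistinct (λ u → P u × Adj G y u)
  head-neighbours {ys = r ∷ []} (s≤s () , _)
  head-neighbours {ys = r ∷ s ∷ rs} (_ , cons _ _ _ y~r _ , closing , _ ∷ (r∉ ∷ _) , inP) =
    r , last r (s ∷ rs) , (λ r≡last → All.lookup r∉ (last-∈ r s rs) r≡last) ,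
    (All.lookup inP (there (here refl)) , y~r) ,
    (All.lookup inP (there (there (last-∈ r s rs))) , Adj-sym closing)

  cycle-neighbours : ∀ {P y} pre post → IsCycleIn P (pre ++ y ∷ post) →
    TwoDistinct (λ u → P u × Adj G y u)
  cycle-neighbours []        post c = head-neighbours c
  cycle-neighbours (x ∷ pre) post c =
    cycle-neighbours pre (post ++ [ x ]) (subst (IsCycleIn _) (++-assoc pre (_ ∷ post) [ x ]) (rotate c))

  -- On a cycle, the vertex of least level has two distinct neighbours of no smaller level.
  levels⇒acyclic : (S : Fin n → Set) (level : Fin n → ℕ) →
    (∀ {v} → S v → ¬ TwoDistinct (λ u → S u × Adj G v u × level v < level u)) →
    (∀ {u v} → S u → S v → u ≢ v → level u ≢ level v) →
    InducesForest G S
  levels⇒acyclic S level sparse separated cycle =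
    sparse (All.lookup inS m∈) (TwoDistinct-map higher neighbours)
    where
    open CycleIn cycle

    m = argmin level v₀ rest

    m∈ : m ∈ v₀ ∷ rest
    m∈ with argmin-sel level v₀ rest
    ... | inj₁ m≡v₀   = here m≡v₀
    ... | inj₂ m∈rest = there m∈rest

    Above : Fin n → Set
    Above w = S w × level m ≤ level w

    neighbours : TwoDistinct (λ u → Above u × Adj G m u)
    neighbours with ∈-∃++ m∈
    ... | pre , post , vs≡ = cycle-neighbours pre post (subst (IsCycleIn Above) vs≡
      (long , path , closing , distinct , All.zip (inS , f[argmin]≤f[⊤] {f = level} v₀ rest ∷ f[argmin]≤f[xs] {f = level} v₀ rest)))

    higher : ∀ {u} → Above u × Adj G m u → S u × Adj G m u × level m < level u
    higher ((u∈S , m≤u) , m~u) =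
      u∈S , m~u , ≤∧≢⇒< m≤u (separated (All.lookup inS m∈) u∈S (Adj-irrefl m~u))

-- Equitable colourings

InjectiveOn : {n t : ℕ} → List (Fin n) → (Fin n → Fin t) → Set
InjectiveOn S h = ∀ {u v} → u ∈ S → v ∈ S → h u ≡ h v → u ≡ v

missingColour : {t : ℕ} (cs : List (Fin t)) → length cs < t → ∃ λ c → c ∉ cs
missingColour cs short with count<n⇒nonMember (λ c → does (c ∈? cs)) (≤-<-trans (count-∈?-≤ cs) short)
... | c , c∉ = c , λ c∈ → case trans (sym (dec-true (c ∈? cs) c∈)) c∉ of λ ()

module _ {n t : ℕ} where

  injectiveOn-∷ : ∀ {v S c} {h : Fin n → Fin t} → v ∉ S → InjectiveOn S h → c ∉ map h S →
    InjectiveOn (v ∷ S) (updateAt h v (const c))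
  injectiveOn-∷ {v} {S} {c} {h} v∉S inj c∉hS = injective
    where
    kept : ∀ {u} → u ∈ S → updateAt h v (const c) u ≡ h u
    kept u∈S = updateAt-minimal _ v h (λ { refl → v∉S u∈S })
    fresh : ∀ {u} → u ∈ S → updateAt h v (const c) u ≡ updateAt h v (const c) v → c ∈ map h S
    fresh {u} u∈S eq = subst (_∈ map h S) (trans (sym (kept u∈S)) (trans eq (updateAt-updates v h))) (∈-map⁺ h u∈S)
    injective : InjectiveOn (v ∷ S) (updateAt h v (const c))
    injective (here refl)  (here refl)  _  = refl
    injective (here refl)  (there u∈S) eq = ⊥-elim (c∉hS (fresh u∈S (sym eq)))
    injective (there u∈S) (here refl)  eq = ⊥-elim (c∉hS (fresh u∈S eq))
    injective (there u∈S) (there w∈S) eq = inj u∈S w∈S (trans (sym (kept u∈S)) (trans eq (kept w∈S)))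

  injectiveOn⇒unique : ∀ {S} {h : Fin n → Fin t} → Unique S → InjectiveOn S h → Unique (map h S)
  injectiveOn⇒unique {[]}    _              _   = []
  injectiveOn⇒unique {v ∷ S} (v∉S ∷ unique) inj =
    map⁺ (All.tabulate (λ u∈S hv≡hu → All.lookup v∉S u∈S (inj (here refl) (there u∈S) hv≡hu)))
    ∷ injectiveOn⇒unique unique (λ u∈ w∈ → inj (there u∈) (there w∈))

  record AvoidingColouring (h₀ : Fin n → Fin t) (ws : List (Fin n)) (Bad : Fin n → Fin t → Set) : Set where
    field
      colour    : Fin n → Fin t
      injective : InjectiveOn ws colour
      avoiding  : All (λ w → ¬ Bad w (colour w)) ws
      unchanged : ∀ {v} → v ∉ ws → colour v ≡ h₀ v

  colourAvoiding : (h₀ : Fin n → Fin t) (ws : List (Fin n)) → Unique ws → (Bad : Fin n → Fin t → Set) →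
    All (λ w → AtMost₁ (Bad w)) ws → length ws < t → AvoidingColouring h₀ ws Bad
  colourAvoiding h₀ [] _ Bad _ _ = record
    { colour = h₀ ; injective = λ () ; avoiding = [] ; unchanged = λ _ → refl }
  colourAvoiding h₀ (w ∷ ws) (w∉ws ∷ unique) Bad ((b , onlyB) ∷ bads) short = record
    { colour = h′
    ; injective = injectiveOn-∷ (All¬⇒¬Any w∉ws) injective (proj₂ fresh ∘ there)
    ; avoiding = avoid-w ∷ All.zipWith (λ (avoid , w≢w′) → avoid ∘ subst (Bad _) (elsewhere (w≢w′ ∘ sym)))
                                       (avoiding , w∉ws)
    ; unchanged = λ v∉ → trans (elsewhere (v∉ ∘ here)) (unchanged (v∉ ∘ there))
    }
    where
    open AvoidingColouring (colourAvoiding h₀ ws unique Bad bads (<-trans (n<1+n _) short))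
    fresh : ∃ λ c → c ∉ b ∷ map colour ws
    fresh = missingColour (b ∷ map colour ws) (subst (_< t) (cong suc (sym (length-map colour ws))) short)
    h′ : Fin n → Fin t
    h′ = updateAt colour w (const (proj₁ fresh))
    elsewhere : ∀ {v} → v ≢ w → h′ v ≡ colour v
    elsewhere {v} = updateAt-minimal v w colour
    avoid-w : ¬ Bad w (h′ w)
    avoid-w bad = proj₂ fresh (here (onlyB (subst (Bad w) (updateAt-updates w colour) bad)))

module _ {n : ℕ} {G : Graph n} (outerplanar : Outerplanar G) where

  pair⇒lightVertex : ∀ {Q} → LightPair G Q → ∃ λ z → Q z ≡ true × AtMost₃ (NeighboursIn G (Q ∖ [ z ]) z)
  pair⇒lightVertex {Q} pair = x , x∈R , proj₁ x-light , y , y , among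
    where
    open LightPair pair
    among : ∀ {u} → NeighboursIn G (Q ∖ [ x ]) x u → u ≡ proj₁ x-light ⊎ u ≡ y ⊎ u ≡ y
    among {u} (u∈ , x~u) with u ≟ y
    ... | yes u≡y = inj₂ (inj₁ u≡y)
    ... | no u≢y  = inj₁ (proj₂ x-light {u} (remaining , x~u))
      where
      remaining : (Q ∖ (x ∷ y ∷ [])) u ≡ true
      remaining = trans (∖-∉ (Q ∖ [ x ]) {[ y ]} λ { (here u≡y) → u≢y u≡y }) u∈

  lightVertex : (Q : Fin n → Bool) → 0 < count Q →
    ∃ λ z → Q z ≡ true × AtMost₃ (NeighboursIn G (Q ∖ [ z ]) z)
  lightVertex Q nonempty with 2 ≤? count Q
  ... | yes two = pair⇒lightVertex (outerplanar-lightPair {G = G} outerplanar Q two)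
  ... | no ¬two with 0<count⇒member Q nonempty
  ...   | z , z∈Q = z , z∈Q , z , z , z , λ (u∈ , _) → ⊥-elim (count<2⇒∖-empty Q z∈Q ¬two u∈)

  record Peeling (k : ℕ) (Q : Fin n → Bool) : Set where
    field
      zs         : List (Fin n)
      members    : All (λ z → Q z ≡ true) zs
      distinct   : Unique zs
      bounded    : length zs ≤ k
      exhaustive : length zs ≡ k ⊎ count (Q ∖ zs) ≡ 0
      light      : All (λ z → AtMost₃ (NeighboursIn G (Q ∖ zs) z)) zs

  peel-∷ : ∀ {k Q z} → Q z ≡ true → AtMost₃ (NeighboursIn G (Q ∖ [ z ]) z) →
    Peeling k (Q ∖ [ z ]) → Peeling (suc k) Q
  peel-∷ {k} {Q} {z} z∈Q z-light rest = record
    { zs = z ∷ zs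
    ; members = z∈Q ∷ All.map (∖-⊆ Q [ z ]) members
    ; distinct = All.map (λ z′∈ z≡z′ → ∖-∉⁻ Q {[ z ]} z′∈ (here (sym z≡z′))) members ∷ distinct
    ; bounded = s≤s bounded
    ; exhaustive = Sum.map₁ (cong suc) exhaustive
    ; light = AtMost₃-mono (λ (u∈ , z~u) → ∖-⊆ (Q ∖ [ z ]) zs u∈ , z~u) z-light ∷ light
    }
    where open Peeling rest

  -- Each removed vertex is light in the set left when it is removed, hence in the final remainder.
  peel : ∀ k Q → Peeling k Q
  peel zero    Q = record
    { zs = [] ; members = [] ; distinct = [] ; bounded = z≤n ; exhaustive = inj₁ refl ; light = [] }
  peel (suc k) Q with 0 <? count Q
  ... | no empty = record
    { zs = [] ; members = [] ; distinct = [] ; bounded = z≤n ; exhaustive = inj₂ (n≤0⇒n≡0 (≮⇒≥ empty)) ; light = [] }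
  ... | yes nonempty with lightVertex Q nonempty
  ...   | z , z∈Q , z-light = peel-∷ z∈Q z-light (peel k (Q ∖ [ z ]))

  module _ {t : ℕ} (2≤t : 2 ≤ t) where

    record Batch (R : Fin n → Bool) : Set where
      field
        x          : Fin n
        ws         : List (Fin n)
        members    : All (λ v → R v ≡ true) (x ∷ ws)
        distinct   : Unique (x ∷ ws)
        short      : length ws < t
        exhaustive : length (x ∷ ws) ≡ t ⊎ count (R ∖ (x ∷ ws)) ≡ 0
        x-light    : AtMost₁ (NeighboursIn G (R ∖ (x ∷ ws)) x)
        ws-light   : All (λ w → AtMost₃ (NeighboursIn G (R ∖ (x ∷ ws)) w)) ws

      remaining : Fin n → Bool
      remaining = R ∖ (x ∷ ws)

    pair⇒batch : ∀ {R} → LightPair G R → Batch R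
    pair⇒batch {R} pair = record
      { x = x ; ws = y ∷ zs
      ; members = x∈R ∷ y∈R ∷ All.map (∖-⊆ R (x ∷ y ∷ [])) members
      ; distinct = (x≢y ∷ All.map (λ z∈ x≡z → outside z∈ (here (sym x≡z))) members)
                 ∷ All.map (λ z∈ y≡z → outside z∈ (there (here (sym y≡z)))) members ∷ distinct
      ; short = ≤-trans (s≤s (s≤s bounded)) (≤-reflexive (m+[n∸m]≡n 2≤t))
      ; exhaustive = Sum.map₁ (λ zs≡ → trans (cong (2 +_) zs≡) (m+[n∸m]≡n 2≤t)) exhaustive
      ; x-light = AtMost₁-mono remaining⊆ x-light
      ; ws-light = AtMost₃-mono remaining⊆ y-light ∷ light
      }
      where
      open LightPair pair
      open Peeling (peel (t ∸ 2) (R ∖ (x ∷ y ∷ [])))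
      outside : ∀ {z} → (R ∖ (x ∷ y ∷ [])) z ≡ true → z ∉ x ∷ y ∷ []
      outside = ∖-∉⁻ R
      remaining⊆ : ∀ {w u} → NeighboursIn G (R ∖ (x ∷ y ∷ zs)) w u → NeighboursIn G (R ∖ (x ∷ y ∷ [])) w u
      remaining⊆ (u∈ , w~u) = ∖-⊆ (R ∖ (x ∷ y ∷ [])) zs u∈ , w~u

    batch : (R : Fin n → Bool) → 0 < count R → Batch R
    batch R nonempty with 2 ≤? count R
    ... | yes two = pair⇒batch (outerplanar-lightPair {G = G} outerplanar R two)
    ... | no ¬two with 0<count⇒member R nonempty
    ...   | x , x∈R = record
      { x = x ; ws = [] ; members = x∈R ∷ [] ; distinct = [] ∷ [] ; short = ≤-trans (s≤s z≤n) 2≤t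
      ; exhaustive = inj₂ (none⇒count≡0 (R ∖ [ x ]) none)
      ; x-light = x , λ (u∈ , _) → ⊥-elim (count<2⇒∖-empty R x∈R ¬two u∈) ; ws-light = [] }
      where
      none : ∀ u → (R ∖ [ x ]) u ≡ false
      none u with (R ∖ [ x ]) u in u∈
      ... | true  = ⊥-elim (count<2⇒∖-empty R x∈R ¬two u∈)
      ... | false = refl

    classSizeIn : (Fin n → Bool) → (Fin n → Fin t) → Fin t → ℕ
    classSizeIn R colour i = count (λ v → R v ∧ (colour v == i))

    classSizeIn-≤ : ∀ R colour i → classSizeIn R colour i ≤ count R
    classSizeIn-≤ R colour i = count-mono (λ v → ∧-conicalˡ (R v) _)

    -- The level conditions make every colour class a forest (levels⇒acyclic).
    record LevelledColouring (R : Fin n → Bool) : Set where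
      field
        colour    : Fin n → Fin t
        level     : Fin n → ℕ
        equitable : ∀ i j → classSizeIn R colour i ≤ classSizeIn R colour j + 1
        sparse    : ∀ {v} → R v ≡ true →
          ¬ TwoDistinct (λ u → NeighboursIn G R v u × level v < level u × colour u ≡ colour v)
        separated : ∀ {u v} → R u ≡ true → R v ≡ true → u ≢ v → level u ≡ level v → colour u ≢ colour v

    -- The batch takes level 0, below every vertex coloured earlier, and gets distinct colours.
    module Extend {R : Fin n → Bool} (B : Batch R) (C : LevelledColouring (Batch.remaining B)) where
      open Batch B
      open LevelledColouring C renaming
        (colour to colour₀; level to level₀; equitable to equitable₀; sparse to sparse₀; separated to separated₀)

      S : List (Fin n)
      S = x ∷ ws

      Bad : Fin n → Fin t → Set
      Bad w c = TwoDistinct (λ u → NeighboursIn G remaining w u × colour₀ u ≡ c)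

      x∉ws : x ∉ ws
      x∉ws = All¬⇒¬Any (AllPairs.head distinct)

      private
        greedy : AvoidingColouring colour₀ ws Bad
        greedy = colourAvoiding colour₀ ws (AllPairs.tail distinct) Bad
          (All.map (AtMost₃⇒AtMost₁-repeatedColour _≟_ colour₀) ws-light) short
        h : Fin n → Fin t
        h = AvoidingColouring.colour greedy
        final : ∃ λ c → c ∉ map h ws
        final = missingColour (map h ws) (subst (_< t) (sym (length-map h ws)) short)

      colour : Fin n → Fin t
      colour = updateAt h x (const (proj₁ final))

      colour-injective : InjectiveOn S colour
      colour-injective = injectiveOn-∷ x∉ws (AvoidingColouring.injective greedy) (proj₂ final)

      colour-ws : ∀ {w} → w ∈ ws → colour w ≡ h w
      colour-ws w∈ws = updateAt-minimal _ x h (λ { refl → x∉ws w∈ws })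

      colour-outside : ∀ {v} → v ∉ S → colour v ≡ colour₀ v
      colour-outside v∉S = trans (updateAt-minimal _ x h (v∉S ∘ here)) (AvoidingColouring.unchanged greedy (v∉S ∘ there))

      inS : Fin n → Bool
      inS v = does (v ∈? S)

      inS-∈ : ∀ {v} → v ∈ S → inS v ≡ true
      inS-∈ {v} = dec-true (v ∈? S)

      inS-∉ : ∀ {v} → v ∉ S → inS v ≡ false
      inS-∉ {v} = dec-false (v ∈? S)

      level : Fin n → ℕ
      level v = if inS v then 0 else suc (level₀ v)

      level-∈ : ∀ {v} → v ∈ S → level v ≡ 0
      level-∈ v∈S rewrite inS-∈ v∈S = refl

      level-∉ : ∀ {v} → v ∉ S → level v ≡ suc (level₀ v)
      level-∉ v∉S rewrite inS-∉ v∉S = refl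

      above⇒∉ : ∀ {u v} → level v < level u → u ∉ S
      above⇒∉ {u} {v} v<u u∈S = <⇒≱ v<u (subst (_≤ level v) (sym (level-∈ u∈S)) z≤n)

      remaining-∉ : ∀ {v} → R v ≡ true → v ∉ S → remaining v ≡ true
      remaining-∉ v∈R v∉S = trans (∖-∉ R v∉S) v∈R

      above⇒remaining : ∀ {u v} → NeighboursIn G R v u → level v < level u → NeighboursIn G remaining v u
      above⇒remaining (u∈R , v~u) v<u = remaining-∉ u∈R (above⇒∉ v<u) , v~u

      used : Fin t → ℕ
      used i = count (λ v → inS v ∧ (colour v == i))

      classSizeIn-split : ∀ i → classSizeIn R colour i ≡ classSizeIn remaining colour₀ i + used i
      classSizeIn-split i = trans (count-cong split) (count-∨-disjoint _ _ disjoint)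
        where
        split : ∀ v → R v ∧ (colour v == i) ≡ (remaining v ∧ (colour₀ v == i)) ∨ (inS v ∧ (colour v == i))
        split v with v ∈? S
        ... | yes v∈S rewrite inS-∈ v∈S | ∖-∈ R v∈S | All.lookup members v∈S = refl
        ... | no v∉S  rewrite inS-∉ v∉S | ∖-∉ R v∉S | colour-outside v∉S = sym (∨-identityʳ _)
        disjoint : ∀ v → (remaining v ∧ (colour₀ v == i)) ∧ (inS v ∧ (colour v == i)) ≡ false
        disjoint v with v ∈? S
        ... | yes v∈S rewrite ∖-∈ R v∈S = refl
        ... | no v∉S  rewrite inS-∉ v∉S = ∧-zeroʳ _

      used-≤1 : ∀ i → used i ≤ 1
      used-≤1 i = ≤-pred (≰⇒> λ two → let u , v , u≢v , pu , pv = 2≤count⇒TwoDistinct _ two in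
        u≢v (colour-injective (does-∈?⇒∈ (∧-conicalˡ _ _ pu)) (does-∈?⇒∈ (∧-conicalˡ _ _ pv))
          (trans (==⇒≡ (∧-conicalʳ _ _ pu)) (sym (==⇒≡ (∧-conicalʳ _ _ pv))))))

      -- A full batch meets every colour, being coloured injectively with t colours.
      used-full : length S ≡ t → ∀ i → 0 < used i
      used-full full i with ∈-map⁻ colour (does-∈?⇒∈ (count≡n⇒all (λ c → does (c ∈? map colour S)) allColours i))
        where
        allColours : count (λ c → does (c ∈? map colour S)) ≡ t
        allColours = trans (count-∈?-unique (injectiveOn⇒unique distinct colour-injective))
                           (trans (length-map colour S) full)
      ... | v , v∈S , i≡colour-v = member⇒0<count (λ v → inS v ∧ (colour v == i)) {v}
          (cong₂ _∧_ (inS-∈ v∈S) (dec-true (colour v ≟ i) (sym i≡colour-v)))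

      equitable : ∀ i j → classSizeIn R colour i ≤ classSizeIn R colour j + 1
      equitable i j rewrite classSizeIn-split i | classSizeIn-split j with exhaustive
      ... | inj₁ full = begin
        classSizeIn remaining colour₀ i + used i      ≤⟨ +-monoʳ-≤ _ (used-≤1 i) ⟩
        classSizeIn remaining colour₀ i + 1           ≤⟨ +-monoˡ-≤ 1 (equitable₀ i j) ⟩
        classSizeIn remaining colour₀ j + 1 + 1       ≤⟨ +-monoˡ-≤ 1 (+-monoʳ-≤ _ (used-full full j)) ⟩
        classSizeIn remaining colour₀ j + used j + 1  ∎
        where open ≤-Reasoning
      ... | inj₂ empty = begin
        classSizeIn remaining colour₀ i + used i      ≤⟨ +-mono-≤ (≤-trans (classSizeIn-≤ remaining colour₀ i)
                                                                            (≤-reflexive empty))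
                                                                  (used-≤1 i) ⟩
        1                                             ≤⟨ m≤n+m 1 _ ⟩
        classSizeIn remaining colour₀ j + used j + 1  ∎
        where open ≤-Reasoning

      sparse : ∀ {v} → R v ≡ true →
        ¬ TwoDistinct (λ u → NeighboursIn G R v u × level v < level u × colour u ≡ colour v)
      sparse {v} v∈R two with v ∈? S
      ... | yes (here refl) = AtMost₁⇒¬TwoDistinct x-light
          (TwoDistinct-map (λ (nb , x<u , _) → above⇒remaining nb x<u) two)
      ... | yes (there v∈ws) = All.lookup (AvoidingColouring.avoiding greedy) v∈ws
          (TwoDistinct-map (λ (nb , v<u , same) → above⇒remaining nb v<u ,
            trans (sym (colour-outside (above⇒∉ v<u))) (trans same (colour-ws v∈ws))) two)
      ... | no v∉S = sparse₀ (remaining-∉ v∈R v∉S)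
          (TwoDistinct-map (λ (nb , v<u , same) → above⇒remaining nb v<u ,
            ≤-pred (subst₂ _<_ (level-∉ v∉S) (level-∉ (above⇒∉ v<u)) v<u) ,
            trans (sym (colour-outside (above⇒∉ v<u))) (trans same (colour-outside v∉S))) two)

      separated : ∀ {u v} → R u ≡ true → R v ≡ true → u ≢ v → level u ≡ level v → colour u ≢ colour v
      separated {u} {v} u∈R v∈R u≢v same with u ∈? S | v ∈? S
      ... | yes u∈S | yes v∈S = u≢v ∘ colour-injective u∈S v∈S
      ... | yes u∈S | no v∉S  = ⊥-elim (0≢1+n (trans (sym (level-∈ u∈S)) (trans same (level-∉ v∉S))))
      ... | no u∉S  | yes v∈S = ⊥-elim (0≢1+n (trans (sym (level-∈ v∈S)) (trans (sym same) (level-∉ u∉S))))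
      ... | no u∉S  | no v∉S  = λ colour-u≡colour-v → separated₀ (remaining-∉ u∈R u∉S) (remaining-∉ v∈R v∉S) u≢v
          (suc-injective (trans (sym (level-∉ u∉S)) (trans same (level-∉ v∉S))))
          (trans (sym (colour-outside u∉S)) (trans colour-u≡colour-v (colour-outside v∉S)))

      result : LevelledColouring R
      result = record
        { colour = colour ; level = level ; equitable = equitable ; sparse = sparse ; separated = separated }

    emptyColouring : ∀ R → count R ≡ 0 → LevelledColouring R
    emptyColouring R empty = record
      { colour = colour ; level = λ _ → 0
      ; equitable = λ i _ → ≤-trans (≤-trans (classSizeIn-≤ R colour i) (≤-reflexive empty)) z≤n
      ; sparse = λ v∈R → ⊥-elim (absent v∈R) ; separated = λ u∈R → ⊥-elim (absent u∈R) }
      where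
      colour : Fin n → Fin t
      colour _ = fromℕ< (≤-trans (s≤s z≤n) 2≤t)
      absent : ∀ {v} → R v ≡ true → ⊥
      absent v∈R = <-irrefl (sym empty) (member⇒0<count R v∈R)

    shrinks : ∀ {R} (B : Batch R) → count (Batch.remaining B) < count R
    shrinks {R} B = count-mono-< (λ v → ∖-⊆ R (x ∷ ws)) x (∖-∈ R {x ∷ ws} (here refl)) (All.head members)
      where open Batch B

    levelledColouring : ∀ k R → count R ≤ k → LevelledColouring R
    levelledColouring k R bound with 0 <? count R
    ... | no empty = emptyColouring R (n≤0⇒n≡0 (≮⇒≥ empty))
    levelledColouring zero    R bound | yes nonempty = ⊥-elim (<⇒≱ nonempty bound)
    levelledColouring (suc k) R bound | yes nonempty with batch R nonempty
    ... | B = Extend.result B (levelledColouring k (Batch.remaining B) (≤-pred (≤-trans (shrinks B) bound)))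

length-filter-tabulate : ∀ {k} (f : Fin n → Fin t) (i : Fin t) (g : Fin k → Fin n) →
  length (filter (λ v → f v ≟ i) (tabulate g)) ≡ count (λ j → f (g j) == i)
length-filter-tabulate {k = zero}  f i g = refl
length-filter-tabulate {k = suc k} f i g with f (g zero) ≟ i
... | yes _ = cong suc (length-filter-tabulate f i (λ j → g (suc j)))
... | no _  = length-filter-tabulate f i (λ j → g (suc j))

classSize≡count : (f : Fin n → Fin t) (i : Fin t) → classSize f i ≡ count (λ v → f v == i)
classSize≡count f i = length-filter-tabulate f i (λ v → v)

CycleIn-mono : {G : Graph n} {S S′ : Fin n → Set} → (∀ {v} → S v → S′ v) → CycleIn G S → CycleIn G S′
CycleIn-mono S⊆S′ cycle = record
  { v₀ = v₀ ; rest = rest ; long = long ; path = path ; closing = closing ; distinct = distinct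
  ; inS = All.map S⊆S′ inS }
  where open CycleIn cycle

outerplanar⇒equitableTreeColouring : {G : Graph n} → Outerplanar G → 2 ≤ t → HasEquitableTreeColoring G t
outerplanar⇒equitableTreeColouring {n} {t} {G} outerplanar 2≤t = colour , equitable′ , forest
  where
  open LevelledColouring (levelledColouring {G = G} outerplanar 2≤t n (λ _ → true) (count-≤ (λ _ → true)))

  equitable′ : Equitable colour
  equitable′ i j = subst₂ (λ a b → a ≤ b + 1) (sym (classSize≡count colour i)) (sym (classSize≡count colour j))
    (equitable i j)

  forest : ∀ i → InducesForest G (λ v → colour v ≡ i)
  forest i = levels⇒acyclic G (λ v → colour v ≡ i) level
    (λ v∈ two → sparse refl (TwoDistinct-map (λ (u∈ , v~u , v<u) → (refl , v~u) , v<u , trans u∈ (sym v∈)) two))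
    (λ u∈ v∈ u≢v same → separated refl refl u≢v same (trans u∈ (sym v∈)))

Fin1-unique : (i j : Fin 1) → i ≡ j
Fin1-unique zero zero = refl

forest⇒equitableTreeColouring₁ : {G : Graph n} → IsForest G → HasEquitableTreeColoring G 1
forest⇒equitableTreeColouring₁ {G = G} forest = colour ,
  (λ i j → subst (λ k → classSize colour i ≤ classSize colour k + 1) (Fin1-unique i j) (m≤m+n _ 1)) ,
  (λ _ → forest ∘ CycleIn-mono (λ _ → tt))
  where
  colour : Fin _ → Fin 1
  colour _ = zero

equitableTreeColouring₁⇒forest : {G : Graph n} → HasEquitableTreeColoring G 1 → IsForest G
equitableTreeColouring₁⇒forest (colour , _ , forest) = forest zero ∘ CycleIn-mono (λ {v} _ → Fin1-unique (colour v) zero)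

theorem3p10 : ∀ (n : ℕ) (G : Graph n) → Outerplanar G →
    (∀ (t : ℕ) → 2 ≤ t → HasEquitableTreeColoring G t)
    × (¬ IsForest G → VaEquals G 2)
    × (IsForest G → VaEquals G 1)
theorem3p10 n G outerplanar = colourable , notForest , isForest
  where
  colourable : ∀ t → 2 ≤ t → HasEquitableTreeColoring G t
  colourable t = outerplanar⇒equitableTreeColouring {G = G} outerplanar

  notForest : ¬ IsForest G → VaEquals G 2
  notForest ¬forest = s≤s z≤n , colourable , λ where
    1 _ _ all → ¬forest (equitableTreeColouring₁⇒forest (all 1 ≤-refl))
    (suc (suc _)) _ (s≤s (s≤s ()))

  isForest : IsForest G → VaEquals G 1
  isForest forest = ≤-refl , all , λ k 1≤k k<1 _ → <⇒≱ k<1 1≤k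
    where
    all : ∀ t → 1 ≤ t → HasEquitableTreeColoring G t
    all 1             _ = forest⇒equitableTreeColouring₁ forest
    all (suc (suc t)) _ = colourable (suc (suc t)) (s≤s (s≤s z≤n))
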